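{- Let $n\in\mathbb{N}$ and $c_1,\dots,c_n\in\mathbb{N}$. Then $$\frac{\sum_{w\in S_n^{(c_1,\dots,c_n)}}t^{\mathrm{des}(w)}}{(1-t)^{n+1}}=\mathrm{Ehr}_{\mathcal{C}_1^{c_1}}(t)\ast\dots\ast\mathrm{Ehr}_{\mathcal{C}_1^{c_n}}(t)=\mathrm{Ehr}_{\mathcal{C}_1^{c_1}\times\dots\times\mathcal{C}_1^{c_n}}(t),$$ i.e. this descent polynomial is the $h^*$-polynomial of an $n$-dimensional box with edge lengths $c_1,\dots,c_n$.
   Context: $S_n^{(c_1,\dots,c_n)}$ is the set of $(c_1,\dots,c_n)$-coloured permutations: pairs $(w,\gamma)$ where $w=w_1\dots w_n$ is a permutation of $[n]$ and $\gamma:[n]\to\mathbb{N}_0$ assigns to position $i$ a colour $\gamma_i\in\{0,\dots,c_{w_i}-1\}$ (the letter $j$ may carry colours $0,\dots,c_j-1$). Setting $w_0=0$, $\gamma_0=0$, $\mathrm{des}(w,\gamma)$ is the number of $i\in\{0,\dots,n-1\}$ such that either ($\gamma_i=\gamma_{i+1}=0$ and $w_i>w_{i+1}$), or ($\gamma_i=\gamma_{i+1}>0$ and $w_i\ge w_{i+1}$), or $\gamma_i<\gamma_{i+1}$. $\mathcal{C}_1^c=\mathrm{conv}\{1,-(c-1)\}=[-(c-1),1]\subset\mathbb{R}$. For a lattice polytope $\mathcal{P}\subset\mathbb{R}^m$, $\mathrm{Ehr}_{\mathcal{P}}(t)=\sum_{k\ge0}|k\mathcal{P}\cap\mathbb{Z}^m|t^k$;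 $\ast$ is the Hadamard product $(\sum a_kt^k)\ast(\sum b_kt^k)=\sum a_kb_kt^k$. -}

module Defs where

open import Data.Nat using (ℕ; zero; suc; _+_; _*_; _∸_; _<_; _≤_; _<ᵇ_; _≤ᵇ_; _≡ᵇ_)
open import Data.Bool using (Bool; true; false; _∧_; _∨_; not; if_then_else_)
open import Data.Fin using (Fin; toℕ; _≟_)
open import Data.Integer as ℤ using (ℤ; +_; -_)
open import Data.Product using (Σ; _×_; _,_)
open import Data.List as List using (List; []; _∷_; allFin; upTo)
open import Data.List.Relation.Unary.All as ListAll using ()
open import Data.Vec as Vec using (Vec; toList; count; lookup)
open import Data.Vec.Relation.Binary.Pointwise.Inductive using (Pointwise)
open import Data.Nat.ListAction using (sum; product)
open import Data.Nat.Combinatorics using (_C_)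
open import Function.Bundles using (_↔_)
open import Relation.Binary.PropositionalEquality using (_≡_)

_HasSize_ : Set → ℕ → Set
A HasSize m = A ↔ Fin m

-- The letter j ∈ [n] is represented by (j : Fin n), i.e. value toℕ j + 1.
-- A permutation of [n] as a word: a vector of length n in which every letter
-- occurs exactly once (stored with proof-irrelevant side conditions so that
-- counting elements of the type is meaningful).
IsPermWord : (n : ℕ) → Vec (Fin n) n → Set
IsPermWord n w = ListAll.All (λ j → count (_≟ j) w ≡ 1) (allFin n)

ColouredPerm : (n : ℕ) → Vec ℕ n → Set
ColouredPerm n c =
  Σ (Vec (Fin n) n) λ w → IsPermWord n w ×
    Σ (Vec ℕ n) λ γ → Pointwise (λ a g → g < lookup c a) w γ

desBit : ℕ × ℕ → ℕ × ℕ → ℕ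
desBit (a , g) (b , h) =
  if ((g ≡ᵇ 0) ∧ (h ≡ᵇ 0) ∧ (b <ᵇ a))
     ∨ ((0 <ᵇ g) ∧ (g ≡ᵇ h) ∧ (b ≤ᵇ a))
     ∨ (g <ᵇ h)
  then 1 else 0

desList : List (ℕ × ℕ) → ℕ
desList [] = 0
desList (x ∷ []) = 0
desList (x ∷ y ∷ r) = desBit x y + desList (y ∷ r)

-- des(w,γ) with w_0 = 0, γ_0 = 0; letter j is encoded with value toℕ j + 1.
des : (n : ℕ) (c : Vec ℕ n) → ColouredPerm n c → ℕ
des n c (w , _ , γ , _) =
  desList ((0 , 0) ∷ List.zip (List.map (λ j → suc (toℕ j)) (toList w)) (toList γ))

DesLevel : (n : ℕ) → Vec ℕ n → ℕ → Set
DesLevel n c j = Σ (ColouredPerm n c) λ p → des n c p ≡ j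

-- lattice points of k·C_1^c = k·[-(c-1),1] = [-(c-1)k, k]
IntervalPts : ℕ → ℕ → Set
IntervalPts c k = Σ ℤ λ z → (- (+ ((c ∸ 1) * k)) ℤ.≤ z) × (z ℤ.≤ + k)

BoxPts : (n : ℕ) → Vec ℕ n → ℕ → Set
BoxPts n c k =
  Σ (Vec ℤ n) λ x → Pointwise (λ ci z → (- (+ ((ci ∸ 1) * k)) ℤ.≤ z) × (z ℤ.≤ + k)) c x

-- coefficient of t^k in (Σ_j D_j t^j) / (1-t)^{n+1}
quotCoeff : ℕ → (ℕ → ℕ) → ℕ → ℕ
quotCoeff n D k = sum (List.map (λ j → ((n + (k ∸ j)) C n) * D j) (upTo (suc k)))

prodFin : (n : ℕ) → (Fin n → ℕ) → ℕ
prodFin n f = product (List.map f (allFin n))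

-- Fix k and let w_n(d) be the coefficient of t^k in t^d / (1 - t)^(n+1). We count the pairs (p , i) of
-- a coloured permutation p and an index i < w_n(des p) in two ways. Grouping them by des p gives the
-- coefficient of t^k in the quotient. On the other hand, every (c_1, …, c_n)-coloured permutation
-- arises exactly once by inserting the letter 1, with one of its c_1 colours, into one of the n slots
-- of a coloured permutation p of {2, …, n}. An insertion raises des by 0 or 1, and summing des over all
-- insertions (a telescoping sum) shows that exactly c_1 des(p) + 1 of them keep it. Pascal's rule for
-- the weights then shows that the insertions into p carry total weight w_(n-1)(des p) (c_1 k + 1), so
-- there are ∏ (c_i k + 1) pairs. This is also the number of lattice points of k (C_1^(c_1) × … ×
-- C_1^(c_n)), a product of intervals with c_i k + 1 points each.
module Submission where

open import Data.Bool using (Bool; true; false; T; if_then_else_; _∧_; _∨_)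
open import Data.Bool.Properties using (∨-zeroʳ; T-≡)
open import Data.Empty using (⊥-elim)
open import Data.Fin as Fin using (Fin; toℕ; fromℕ<; _≟_)
open import Data.Fin.Permutation using (↔⇒≡)
open import Data.Fin.Properties using (¬Fin0; +↔⊎; *↔×; toℕ<n; toℕ-fromℕ<; toℕ-injective; fromℕ<-toℕ)
open import Data.Integer as ℤ using (ℤ; -[1+_]; +≤+; -≤+; -≤-)
import Data.Integer.Properties as ℤ
import Data.List as List
open import Data.List using (applyUpTo)
open import Data.List.Membership.Propositional.Properties using (∈-allFin)
open import Data.List.Properties using (map-tabulate; map-cong)
import Data.List.Relation.Unary.All as ListAll
open import Data.Nat using (ℕ; zero; suc; _+_; _*_; _∸_; _≤_; _<_; _≤ᵇ_; _<ᵇ_; _≡ᵇ_; z≤n; s≤s)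
open import Data.Nat.Combinatorics using (_C_; nCn≡1; nCk+nC[k+1]≡[n+1]C[k+1])
open import Data.Nat.ListAction as ListAction using (product)
open import Data.Nat.Properties using (+-identityʳ; +-comm; +-suc; +-assoc; *-identityʳ; *-zeroʳ; *-comm; *-assoc; *-suc;
  *-distribˡ-+; +-cancelʳ-≡; +-cancelˡ-≡; m≤n⇒∃[o]m+o≡n; m+n∸m≡n; ≤-pred; ≤-<-trans; ≮⇒≥; ≰⇒>; ≤ᵇ⇒≤; ≤⇒≤ᵇ; <ᵇ⇒<;
  <⇒<ᵇ; suc-injective; ≡-irrelevant; <-irrelevant; +-*-semiring)
open import Algebra.Properties.Semiring.Sum +-*-semiring using (sum; sum-syntax; ∑-distrib-+; sum-cong-≗)
open import Data.Nat.Tactic.RingSolver using (solve-∀)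
open import Data.Product using (Σ; _×_; _,_; proj₁; proj₂)
open import Data.Product.Algebra using (×-cong)
open import Data.Product.Function.Dependent.Propositional using (Σ-↔)
open import Data.Sum as Sum using (_⊎_; inj₁; inj₂)
open import Data.Sum.Algebra using (⊎-cong)
open import Data.Vec using (Vec; []; _∷_; toList; insertAt; removeAt; lookup; map; count)
open import Data.Vec.Properties using (removeAt-insertAt; insertAt-removeAt; insertAt-lookup)
open import Data.Vec.Relation.Binary.Pointwise.Inductive as Pointwise using (Pointwise; []; _∷_)
open import Data.Vec.Relation.Unary.All using (All; []; _∷_)
open import Function using (_∘_)
open import Function.Bundles using (_↔_; mk↔ₛ′; Equivalence)
open import Function.Properties.Inverse using (↔-refl; ↔-sym; ↔-trans)
open import Function.Related.Propositional using (module EquationalReasoning)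
open import Relation.Binary.PropositionalEquality
open import Relation.Nullary using (¬_; does)
open import Relation.Unary using (Decidable)

open import Defs

size-unique : ∀ {A : Set} {a b} → A HasSize a → A HasSize b → a ≡ b
size-unique p q = ↔⇒≡ (↔-trans (↔-sym p) q)

Fin-cong : ∀ {a b} → a ≡ b → Fin a ↔ Fin b
Fin-cong refl = ↔-refl

Fin-× : ∀ a b → (Fin a × Fin b) ↔ Fin (a * b)
Fin-× a b = ↔-sym *↔×

Σ-Fin : ∀ n (h : Fin n → ℕ) → Σ (Fin n) (Fin ∘ h) ↔ Fin (∑[ i < n ] h i)
Σ-Fin zero h = mk↔ₛ′ (λ ()) (λ ()) (λ ()) (λ ())
Σ-Fin (suc n) h = ↔-trans split (↔-trans (⊎-cong ↔-refl (Σ-Fin n (h ∘ Fin.suc))) (↔-sym +↔⊎))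
  where
  split : Σ (Fin (suc n)) (Fin ∘ h) ↔ (Fin (h Fin.zero) ⊎ Σ (Fin n) (Fin ∘ h ∘ Fin.suc))
  split = mk↔ₛ′ (λ { (Fin.zero , y) → inj₁ y ; (Fin.suc i , y) → inj₂ (i , y) })
                (λ { (inj₁ y) → Fin.zero , y ; (inj₂ (i , y)) → Fin.suc i , y })
                (λ { (inj₁ y) → refl ; (inj₂ (i , y)) → refl })
                (λ { (Fin.zero , y) → refl ; (Fin.suc i , y) → refl })

Σ-fibres : ∀ {A : Set} (B : ℕ → Set) (f : A → ℕ) →
  Σ A (B ∘ f) ↔ Σ ℕ (λ d → Σ A (λ a → f a ≡ d) × B d)
Σ-fibres B f = mk↔ₛ′ (λ (a , b) → f a , (a , refl) , b) (λ (_ , (a , e) , b) → a , subst B (sym e) b)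
  (λ { (_ , (a , refl) , b) → refl }) (λ _ → refl)

Σℕ-Fin : ∀ n (g : ℕ → ℕ) → (∀ d → n ≤ d → g d ≡ 0) → Σ ℕ (Fin ∘ g) ↔ Fin (∑[ j < n ] g (toℕ j))
Σℕ-Fin zero g vanish = mk↔ₛ′ empty (λ ()) (λ ()) (⊥-elim ∘ ¬Fin0 ∘ empty)
  where
  empty : Σ ℕ (Fin ∘ g) → Fin 0
  empty (d , i) = subst Fin (vanish d z≤n) i
Σℕ-Fin (suc n) g vanish =
  ↔-trans split (↔-trans (⊎-cong ↔-refl (Σℕ-Fin n (g ∘ suc) (λ d → vanish (suc d) ∘ s≤s))) (↔-sym +↔⊎))
  where
  split : Σ ℕ (Fin ∘ g) ↔ (Fin (g 0) ⊎ Σ ℕ (Fin ∘ g ∘ suc))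
  split = mk↔ₛ′ (λ { (zero , y) → inj₁ y ; (suc d , y) → inj₂ (d , y) })
                (λ { (inj₁ y) → zero , y ; (inj₂ (d , y)) → suc d , y })
                (λ { (inj₁ y) → refl ; (inj₂ (d , y)) → refl })
                (λ { (zero , y) → refl ; (suc d , y) → refl })

∑-const : ∀ n c → ∑[ i < n ] c ≡ n * c
∑-const zero c = refl
∑-const (suc n) c = cong (c +_) (∑-const n c)

sum-applyUpTo : ∀ n (f h : ℕ → ℕ) → ListAction.sum (List.map f (applyUpTo h n)) ≡ ∑[ i < n ] f (h (toℕ i))
sum-applyUpTo zero f h = refl
sum-applyUpTo (suc n) f h = cong (f (h 0) +_) (sum-applyUpTo n f (h ∘ suc))

prodFin-suc : ∀ n (f : Fin (suc n) → ℕ) → prodFin (suc n) f ≡ f Fin.zero * prodFin n (f ∘ Fin.suc)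
prodFin-suc n f = cong (f Fin.zero *_) (cong product
  (trans (map-tabulate Fin.suc f) (sym (map-tabulate (λ i → i) (f ∘ Fin.suc)))))

-- Lattice points of dilated intervals and boxes

Interval : ℕ → ℕ → Set
Interval a b = Σ ℤ λ z → (ℤ.- (ℤ.+ a) ℤ.≤ z) × (z ℤ.≤ ℤ.+ b)

Interval-≡ : ∀ {a b z z′} {p p′ q q′} → z ≡ z′ → _≡_ {A = Interval a b} (z , p , q) (z′ , p′ , q′)
Interval-≡ {z = z} {p = p} {p′} {q} {q′} refl =
  cong₂ (λ p q → z , p , q) (ℤ.≤-irrelevant p p′) (ℤ.≤-irrelevant q q′)

Interval-size : ∀ a b → Interval a b HasSize (a + suc b)
Interval-size a b = ↔-trans (mk↔ₛ′ to from to∘from from∘to) (↔-sym +↔⊎)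
  where
  negative-bound : ∀ {a n} → ℤ.- (ℤ.+ a) ℤ.≤ -[1+ n ] → n < a
  negative-bound {suc a} (-≤- n≤a) = s≤s n≤a

  negative-lower : ∀ {a} (i : Fin a) → ℤ.- (ℤ.+ a) ℤ.≤ -[1+ toℕ i ]
  negative-lower {suc a} i = -≤- (≤-pred (toℕ<n i))

  to : Interval a b → Fin a ⊎ Fin (suc b)
  to (ℤ.+ n , _ , +≤+ n≤b) = inj₂ (fromℕ< (s≤s n≤b))
  to (-[1+ n ] , lower , _) = inj₁ (fromℕ< (negative-bound lower))

  from : Fin a ⊎ Fin (suc b) → Interval a b
  from (inj₁ i) = -[1+ toℕ i ] , negative-lower i , -≤+
  from (inj₂ i) = ℤ.+ toℕ i , ℤ.neg-≤-pos , +≤+ (≤-pred (toℕ<n i))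

  to∘from : ∀ i → to (from i) ≡ i
  to∘from (inj₁ i) = cong inj₁ (fromℕ<-toℕ i _)
  to∘from (inj₂ i) = cong inj₂ (fromℕ<-toℕ i _)

  from∘to : ∀ z → from (to z) ≡ z
  from∘to (ℤ.+ n , _ , +≤+ n≤b) = Interval-≡ (cong ℤ.+_ (toℕ-fromℕ< (s≤s n≤b)))
  from∘to (-[1+ n ] , lower , _) = Interval-≡ (cong -[1+_] (toℕ-fromℕ< (negative-bound lower)))

intervalPoints : ℕ → ℕ → ℕ
intervalPoints c k = (c ∸ 1) * k + suc k

boxPoints : ∀ {n} → Vec ℕ n → ℕ → ℕ
boxPoints {n} c k = prodFin n (λ i → intervalPoints (lookup c i) k)

boxPoints-∷ : ∀ {n} x (c : Vec ℕ n) k → boxPoints (x ∷ c) k ≡ intervalPoints x k * boxPoints c k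
boxPoints-∷ {n} x c k = prodFin-suc n (λ i → intervalPoints (lookup (x ∷ c) i) k)

BoxPts-size : ∀ n (c : Vec ℕ n) k → BoxPts n c k HasSize boxPoints c k
BoxPts-size zero [] k =
  mk↔ₛ′ (λ _ → Fin.zero) (λ _ → [] , []) (λ { Fin.zero → refl ; (Fin.suc ()) }) (λ { ([] , []) → refl })
BoxPts-size (suc n) (x ∷ c) k = begin
  BoxPts (suc n) (x ∷ c) k
    ↔⟨ mk↔ₛ′ (λ { (z ∷ zs , p ∷ ps) → (z , p) , (zs , ps) }) (λ ((z , p) , (zs , ps)) → z ∷ zs , p ∷ ps)
             (λ _ → refl) (λ { (z ∷ zs , p ∷ ps) → refl }) ⟩
  (IntervalPts x k × BoxPts n c k)
    ↔⟨ ×-cong (Interval-size ((x ∸ 1) * k) k) (BoxPts-size n c k) ⟩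
  (Fin (intervalPoints x k) × Fin (boxPoints c k))
    ↔⟨ Fin-× _ _ ⟩
  Fin (intervalPoints x k * boxPoints c k)
    ↔⟨ Fin-cong (boxPoints-∷ x c k) ⟨
  Fin (boxPoints (x ∷ c) k)
    ∎
  where open EquationalReasoning

-- Binomial weights

choose+ : ℕ → ℕ → ℕ
choose+ zero N = 1
choose+ (suc m) zero = 1
choose+ (suc m) (suc N) = choose+ m (suc N) + choose+ (suc m) N

choose+≡C : ∀ m N → choose+ m N ≡ (m + N) C m
choose+≡C zero N = refl
choose+≡C (suc m) zero = sym (trans (cong (_C suc m) (+-identityʳ (suc m))) (nCn≡1 (suc m)))
choose+≡C (suc m) (suc N) = begin
  choose+ m (suc N) + choose+ (suc m) N  ≡⟨ cong₂ _+_ (choose+≡C m (suc N)) (choose+≡C (suc m) N) ⟩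
  (m + suc N) C m + (suc m + N) C suc m  ≡⟨ cong (λ t → (m + suc N) C m + t C suc m) (sym (+-suc m N)) ⟩
  (m + suc N) C m + (m + suc N) C suc m  ≡⟨ nCk+nC[k+1]≡[n+1]C[k+1] (m + suc N) m ⟩
  suc (m + suc N) C suc m                ∎
  where open ≡-Reasoning

choose+-one : ∀ m → choose+ m 1 ≡ suc m
choose+-one zero = refl
choose+-one (suc m) = trans (cong (_+ 1) (choose+-one m)) (+-comm (suc m) 1)

choose+-zero : ∀ m → choose+ m 0 ≡ 1
choose+-zero zero = refl
choose+-zero (suc m) = refl

one-choose+ : ∀ N → choose+ 1 N ≡ suc N
one-choose+ zero = refl
one-choose+ (suc N) = cong suc (one-choose+ N)

choose+-absorb : ∀ m N → suc m * choose+ (suc m) N ≡ suc N * choose+ m (suc N)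
choose+-absorb m zero = trans (*-identityʳ (suc m)) (sym (trans (+-identityʳ _) (choose+-one m)))
choose+-absorb zero (suc N) = trans (+-identityʳ _) (trans (cong suc (one-choose+ N)) (sym (*-identityʳ _)))
choose+-absorb (suc m) (suc N) = begin
  suc (suc m) * (A + B)                ≡⟨ *-distribˡ-+ (suc (suc m)) A B ⟩
  suc (suc m) * A + suc (suc m) * B    ≡⟨ cong (suc (suc m) * A +_) (choose+-absorb (suc m) N) ⟩
  suc (suc m) * A + suc N * A          ≡⟨ shift (suc m) N A ⟩
  suc m * A + suc (suc N) * A          ≡⟨ cong (_+ suc (suc N) * A) (choose+-absorb m (suc N)) ⟩
  suc (suc N) * C′ + suc (suc N) * A   ≡⟨ *-distribˡ-+ (suc (suc N)) C′ A ⟨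
  suc (suc N) * (C′ + A)               ∎
  where
  open ≡-Reasoning
  A = choose+ (suc m) (suc N)
  B = choose+ (suc (suc m)) N
  C′ = choose+ m (suc (suc N))
  shift : ∀ a b x → suc a * x + suc b * x ≡ a * x + suc (suc b) * x
  shift = solve-∀

-- quotWeight n k d is the coefficient of t^k in t^d / (1 - t)^(n+1)
quotWeight : ℕ → ℕ → ℕ → ℕ
quotWeight n k zero = choose+ n k
quotWeight n zero (suc d) = 0
quotWeight n (suc k) (suc d) = quotWeight n k d

quotWeight-diagonal : ∀ n d N → quotWeight n (d + N) d ≡ choose+ n N
quotWeight-diagonal n zero N = refl
quotWeight-diagonal n (suc d) N = quotWeight-diagonal n d N

quotWeight-vanish : ∀ n {k d} → k < d → quotWeight n k d ≡ 0
quotWeight-vanish n {zero} {suc d} _ = refl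
quotWeight-vanish n {suc k} {suc d} (s≤s k<d) = quotWeight-vanish n k<d

quotWeight≡C : ∀ n {k d} → d ≤ k → quotWeight n k d ≡ (n + (k ∸ d)) C n
quotWeight≡C n {d = d} d≤k with N , refl ← m≤n⇒∃[o]m+o≡n d≤k = begin
  quotWeight n (d + N) d  ≡⟨ quotWeight-diagonal n d N ⟩
  choose+ n N             ≡⟨ choose+≡C n N ⟩
  (n + N) C n             ≡⟨ cong (λ t → (n + t) C n) (m+n∸m≡n d N) ⟨
  (n + (d + N ∸ d)) C n   ∎
  where open ≡-Reasoning

-- With W = quotWeight (m + 1) k, W′ = quotWeight m k and a = 1 this is the identity
-- (1 + x d) W(d) + (x (m + 1) - 1 - x d) W(d + 1) = W′(d) (1 + x k), with the subtracted term moved to the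
-- right. Shifting both k and d by one turns the instance at a into the instance at a + x.
quotWeight-recurrence : ∀ m x k d a →
  (a + x * d) * quotWeight (suc m) k d + x * suc m * quotWeight (suc m) k (suc d)
  ≡ quotWeight m k d * (a + x * k) + (a + x * d) * quotWeight (suc m) k (suc d)
quotWeight-recurrence m x zero zero a rewrite choose+-zero m = identity (a + x * 0) (x * suc m)
  where
  identity : ∀ a b → a * 1 + b * 0 ≡ 1 * a + a * 0
  identity = solve-∀
quotWeight-recurrence m x zero (suc d) a = identity (a + x * suc d) (x * suc m) (a + x * 0)
  where
  identity : ∀ a b c → a * 0 + b * 0 ≡ 0 * c + a * 0
  identity = solve-∀
quotWeight-recurrence m x (suc k) zero a = begin
  (a + x * 0) * (C′ + B) + x * suc m * B      ≡⟨ cong ((a + x * 0) * (C′ + B) +_) (*-assoc x (suc m) B) ⟩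
  (a + x * 0) * (C′ + B) + x * (suc m * B)    ≡⟨ cong (λ t → (a + x * 0) * (C′ + B) + x * t) (choose+-absorb m k) ⟩
  (a + x * 0) * (C′ + B) + x * (suc k * C′)   ≡⟨ identity a x k C′ B ⟩
  C′ * (a + x * suc k) + (a + x * 0) * B      ∎
  where
  open ≡-Reasoning
  B = choose+ (suc m) k
  C′ = choose+ m (suc k)
  identity : ∀ a x k c b → (a + x * 0) * (c + b) + x * (suc k * c) ≡ c * (a + x * suc k) + (a + x * 0) * b
  identity = solve-∀
quotWeight-recurrence m x (suc k) (suc d) a
  rewrite *-suc x d | *-suc x k | sym (+-assoc a x (x * d)) | sym (+-assoc a x (x * k)) =
  quotWeight-recurrence m x k d (a + x)

-- Families taking two consecutive values

AtMostOneAbove : ℕ → ℕ → Set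
AtMostOneAbove d y = y ≡ d ⊎ y ≡ suc d

AtMostOneAbove-one : ∀ {β} → AtMostOneAbove 0 β → AtMostOneAbove β 1
AtMostOneAbove-one (inj₁ refl) = inj₂ refl
AtMostOneAbove-one (inj₂ refl) = inj₁ refl

AtMostOneAbove-+ˡ : ∀ b {d y} → AtMostOneAbove d y → AtMostOneAbove (b + d) (b + y)
AtMostOneAbove-+ˡ b {d} = Sum.map (cong (b +_)) (λ e → trans (cong (b +_) e) (+-suc b d))

AtMostOneAbove-+ʳ : ∀ c {d y} → AtMostOneAbove d y → AtMostOneAbove (d + c) (y + c)
AtMostOneAbove-+ʳ c = Sum.map (cong (_+ c)) (cong (_+ c))

stays : ∀ {d y} → AtMostOneAbove d y → ℕ
stays (inj₁ _) = 1
stays (inj₂ _) = 0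

AtMostOneAbove-weight : ∀ {d y} (G : ℕ → ℕ) (p : AtMostOneAbove d y) →
  G y + stays p * G (suc d) ≡ stays p * G d + G (suc d)
AtMostOneAbove-weight {d} G (inj₁ refl) = identity (G d) (G (suc d))
  where
  identity : ∀ a b → a + 1 * b ≡ 1 * a + b
  identity = solve-∀
AtMostOneAbove-weight G (inj₂ refl) = +-identityʳ _

∑-affine : ∀ n (f g : Fin n → ℕ) {a b c} → (∀ i → f i + g i * b ≡ g i * a + c) →
  ∑[ i < n ] f i + ∑[ i < n ] g i * b ≡ ∑[ i < n ] g i * a + n * c
∑-affine zero f g h = refl
∑-affine (suc n) f g {a} {b} {c} h = begin
  f₀ + F + (g₀ + G) * b        ≡⟨ regroup f₀ F g₀ G b ⟩
  (f₀ + g₀ * b) + (F + G * b)  ≡⟨ cong₂ _+_ (h Fin.zero) (∑-affine n (f ∘ Fin.suc) (g ∘ Fin.suc) (h ∘ Fin.suc)) ⟩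
  (g₀ * a + c) + (G * a + n * c) ≡⟨ regroup′ g₀ G a c (n * c) ⟩
  (g₀ + G) * a + (c + n * c)   ∎
  where
  open ≡-Reasoning
  f₀ = f Fin.zero
  g₀ = g Fin.zero
  F = ∑[ i < n ] f (Fin.suc i)
  G = ∑[ i < n ] g (Fin.suc i)
  regroup : ∀ f₀ F g₀ G b → f₀ + F + (g₀ + G) * b ≡ (f₀ + g₀ * b) + (F + G * b)
  regroup = solve-∀
  regroup′ : ∀ g₀ G a c nc → (g₀ * a + c) + (G * a + nc) ≡ (g₀ + G) * a + (c + nc)
  regroup′ = solve-∀

module _ {n m d} {y : Fin n → Fin m → ℕ} (two-valued : ∀ i j → AtMostOneAbove d (y i j)) where

  private
    K : ℕ
    K = ∑[ i < n ] ∑[ j < m ] stays (two-valued i j)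

  ∑∑-weight : ∀ G → ∑[ i < n ] ∑[ j < m ] G (y i j) + K * G (suc d) ≡ K * G d + n * (m * G (suc d))
  ∑∑-weight G = ∑-affine n _ _ λ i → ∑-affine m _ _ λ j → AtMostOneAbove-weight G (two-valued i j)

  ∑∑-stays : ∀ Z → ∑[ i < n ] ∑[ j < m ] y i j + Z ≡ n * (m * suc d) → K ≡ Z
  ∑∑-stays Z total = +-cancelʳ-≡ (K * d) K Z (+-cancelˡ-≡ Y _ _ (begin
    Y + (K + K * d)         ≡⟨ cong (Y +_) (*-suc K d) ⟨
    Y + K * suc d           ≡⟨ ∑∑-weight (λ y → y) ⟩
    K * d + n * (m * suc d) ≡⟨ cong (K * d +_) total ⟨
    K * d + (Y + Z)         ≡⟨ regroup (K * d) Y Z ⟩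
    Y + (Z + K * d)         ∎))
    where
    open ≡-Reasoning
    Y = ∑[ i < n ] ∑[ j < m ] y i j
    regroup : ∀ a y z → a + (y + z) ≡ y + (z + a)
    regroup = solve-∀

  ∑∑-two-values : ∀ Z → ∑[ i < n ] ∑[ j < m ] y i j + Z ≡ n * (m * suc d) →
    ∀ G → ∑[ i < n ] ∑[ j < m ] G (y i j) + Z * G (suc d) ≡ Z * G d + n * (m * G (suc d))
  ∑∑-two-values Z total G =
    subst (λ k → ∑[ i < n ] ∑[ j < m ] G (y i j) + k * G (suc d) ≡ k * G d + n * (m * G (suc d)))
      (∑∑-stays Z total) (∑∑-weight G)

-- Descents under insertion of the letter 1

iverson : Bool → ℕ
iverson b = if b then 1 else 0

desBit-bit : ∀ u v → AtMostOneAbove 0 (desBit u v)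
desBit-bit (a , g) (b , h)
  with ((g ≡ᵇ 0) ∧ (h ≡ᵇ 0) ∧ (b <ᵇ a)) ∨ ((0 <ᵇ g) ∧ (g ≡ᵇ h) ∧ (b ≤ᵇ a)) ∨ (g <ᵇ h)
... | true = inj₂ refl
... | false = inj₁ refl

desBit-colour-ascent : ∀ a g b h → T (g <ᵇ h) → desBit (a , g) (b , h) ≡ 1
desBit-colour-ascent a g b h g<h with g <ᵇ h
... | true rewrite ∨-zeroʳ ((0 <ᵇ g) ∧ (g ≡ᵇ h) ∧ (b ≤ᵇ a)) | ∨-zeroʳ ((g ≡ᵇ 0) ∧ (h ≡ᵇ 0) ∧ (b <ᵇ a)) = refl

desBit-colour-descent : ∀ a g b h → T (h <ᵇ g) → desBit (a , g) (b , h) ≡ 0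
desBit-colour-descent a (suc g) b zero _ = refl
desBit-colour-descent a (suc g) b (suc h) h<g = strict g h (b ≤ᵇ a) h<g
  where
  strict : ∀ g h β → T (h <ᵇ g) → (if false ∨ (g ≡ᵇ h) ∧ β ∨ (g <ᵇ h) then 1 else 0) ≡ 0
  strict (suc g) zero β _ = refl
  strict (suc g) (suc h) β h<g = strict g h β h<g

data Large : ℕ × ℕ → Set where
  large : ∀ a g → Large (2 + a , g)

-- What may precede an inserted letter 1: the sentinel w_0 = 0 of colour 0, or a letter other than 1.
data Head : ℕ × ℕ → Set where
  sentinel : Head (0 , 0)
  letter   : ∀ {u} → Large u → Head u

threshold : ∀ {u} → Head u → ℕ
threshold sentinel = 1
threshold (letter (large a g)) = g

desBit-head-1 : ∀ {u} (hu : Head u) r → desBit u (1 , r) ≡ iverson (threshold hu ≤ᵇ r)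
desBit-head-1 sentinel zero = refl
desBit-head-1 sentinel (suc r) = refl
desBit-head-1 (letter (large a zero)) zero = refl
desBit-head-1 (letter (large a zero)) (suc r) = refl
desBit-head-1 (letter (large a (suc g))) zero = refl
desBit-head-1 (letter (large a (suc g))) (suc r) = colour g r
  where
  colour : ∀ g r → (if (g ≡ᵇ r) ∧ true ∨ (g <ᵇ r) then 1 else 0) ≡ iverson (g <ᵇ suc r)
  colour zero zero = refl
  colour zero (suc r) = refl
  colour (suc g) zero = refl
  colour (suc g) (suc r) = colour g r

desBit-1-large : ∀ r b h → desBit (1 , r) (2 + b , h) ≡ iverson (r <ᵇ h)
desBit-1-large zero b zero = refl
desBit-1-large zero b (suc h) = refl
desBit-1-large (suc r) b zero = refl
desBit-1-large (suc r) b (suc h) with r ≡ᵇ h | r <ᵇ h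
... | false | false = refl
... | false | true = refl
... | true | false = refl
... | true | true = refl

desBit-head-ascent : ∀ {u} (hu : Head u) b h → T (threshold hu <ᵇ h) → desBit u (2 + b , h) ≡ 1
desBit-head-ascent sentinel b (suc h) _ = refl
desBit-head-ascent (letter (large a g)) b h = desBit-colour-ascent (2 + a) g (2 + b) h

desBit-head-descent : ∀ {u} (hu : Head u) b h → T (h <ᵇ threshold hu) → desBit u (2 + b , h) ≡ 0
desBit-head-descent sentinel b zero _ = refl
desBit-head-descent (letter (large a g)) b h = desBit-colour-descent (2 + a) g (2 + b) h

T-true : ∀ {b} → b ≡ true → T b
T-true = Equivalence.from T-≡

¬T-false : ∀ {b} → b ≡ false → ¬ T b
¬T-false refl ()

desBit-insert-1 : ∀ {u} (hu : Head u) r b h →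
  AtMostOneAbove (desBit u (2 + b , h)) (desBit u (1 , r) + desBit (1 , r) (2 + b , h))
desBit-insert-1 {u} hu r b h rewrite desBit-head-1 hu r | desBit-1-large r b h
  with threshold hu ≤ᵇ r in θ≤r | r <ᵇ h in r<h
... | true  | true  = inj₂ (cong suc (sym (desBit-head-ascent hu b h (<⇒<ᵇ θ<h))))
  where
  θ<h : threshold hu < h
  θ<h = ≤-<-trans (≤ᵇ⇒≤ _ r (T-true θ≤r)) (<ᵇ⇒< r h (T-true r<h))
... | true  | false = AtMostOneAbove-one (desBit-bit u (2 + b , h))
... | false | true  = AtMostOneAbove-one (desBit-bit u (2 + b , h))
... | false | false = inj₁ (sym (desBit-head-descent hu b h (<⇒<ᵇ h<θ)))
  where
  h<θ : h < threshold hu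
  h<θ = ≤-<-trans (≮⇒≥ (¬T-false r<h ∘ <⇒<ᵇ)) (≰⇒> (¬T-false θ≤r ∘ ≤⇒≤ᵇ))

iverson-≤ᵇ+<ᵇ : ∀ g r → iverson (g ≤ᵇ r) + iverson (r <ᵇ g) ≡ 1
iverson-≤ᵇ+<ᵇ zero r = refl
iverson-≤ᵇ+<ᵇ (suc g) zero = refl
iverson-≤ᵇ+<ᵇ (suc zero) (suc r) = iverson-≤ᵇ+<ᵇ zero r
iverson-≤ᵇ+<ᵇ (suc (suc g)) (suc r) = iverson-≤ᵇ+<ᵇ (suc g) r

desBit-around-1 : ∀ {v} → Large v → ∀ r → desBit v (1 , r) + desBit (1 , r) v ≡ 1
desBit-around-1 (large a g) r =
  trans (cong₂ _+_ (desBit-head-1 (letter (large a g)) r) (desBit-1-large r a g)) (iverson-≤ᵇ+<ᵇ g r)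

descents : ∀ {ℓ} → ℕ × ℕ → Vec (ℕ × ℕ) ℓ → ℕ
descents u v = desList (u List.∷ toList v)

descents-insert-1 : ∀ {ℓ u} → Head u → {v : Vec (ℕ × ℕ) ℓ} → All Large v → ∀ s r →
  AtMostOneAbove (descents u v) (descents u (insertAt v s (1 , r)))
descents-insert-1 {u = u} hu {[]} [] Fin.zero r = AtMostOneAbove-+ʳ 0 (desBit-bit u (1 , r))
descents-insert-1 {u = u} hu {_ ∷ v} (large b h ∷ _) Fin.zero r
  rewrite sym (+-assoc (desBit u (1 , r)) (desBit (1 , r) (2 + b , h)) (descents (2 + b , h) v)) =
  AtMostOneAbove-+ʳ (descents (2 + b , h) v) (desBit-insert-1 hu r b h)
descents-insert-1 {u = u} hu {a ∷ v} (large-a ∷ large-v) (Fin.suc s) r =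
  AtMostOneAbove-+ˡ (desBit u a) (descents-insert-1 (letter large-a) large-v s r)

∑-around-1 : ∀ x {v} → Large v →
  ∑[ r < x ] desBit v (1 , toℕ r) + ∑[ r < x ] desBit (1 , toℕ r) v ≡ x
∑-around-1 x {v} large-v = begin
  ∑[ r < x ] desBit v (1 , toℕ r) + ∑[ r < x ] desBit (1 , toℕ r) v  ≡⟨ ∑-distrib-+ {x} (λ r → desBit v (1 , toℕ r)) _ ⟨
  ∑[ r < x ] (desBit v (1 , toℕ r) + desBit (1 , toℕ r) v)          ≡⟨ sum-cong-≗ {x} (desBit-around-1 large-v ∘ toℕ) ⟩
  ∑[ r < x ] 1                                                      ≡⟨ ∑-const x 1 ⟩
  x * 1                                                             ≡⟨ *-identityʳ x ⟩
  x                                                                 ∎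
  where open ≡-Reasoning

∑-sentinel-1 : ∀ x → ∑[ r < suc x ] desBit (0 , 0) (1 , toℕ r) ≡ x
∑-sentinel-1 x = trans (∑-const x 1) (*-identityʳ x)

∑-insert-cons : ∀ x u a {ℓ} (v : Vec (ℕ × ℕ) ℓ) →
  ∑[ s < suc (suc ℓ) ] ∑[ r < x ] descents u (insertAt (a ∷ v) s (1 , toℕ r))
  ≡ ∑[ r < x ] desBit u (1 , toℕ r) + (∑[ r < x ] desBit (1 , toℕ r) a + x * descents a v)
    + (suc ℓ * (x * desBit u a) + ∑[ s < suc ℓ ] ∑[ r < x ] descents a (insertAt v s (1 , toℕ r)))
∑-insert-cons x u a {ℓ} v = cong₂ _+_ insert-first insert-later
  where
  β = desBit u a
  y : Fin (suc ℓ) → Fin x → ℕ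
  y s r = descents a (insertAt v s (1 , toℕ r))
  insert-first : ∑[ r < x ] (desBit u (1 , toℕ r) + (desBit (1 , toℕ r) a + descents a v))
    ≡ ∑[ r < x ] desBit u (1 , toℕ r) + (∑[ r < x ] desBit (1 , toℕ r) a + x * descents a v)
  insert-first = trans (∑-distrib-+ {x} (λ r → desBit u (1 , toℕ r)) (λ r → desBit (1 , toℕ r) a + descents a v))
    (cong (∑[ r < x ] desBit u (1 , toℕ r) +_)
      (trans (∑-distrib-+ {x} (λ r → desBit (1 , toℕ r) a) (λ _ → descents a v))
             (cong (∑[ r < x ] desBit (1 , toℕ r) a +_) (∑-const x (descents a v)))))
  insert-later : ∑[ s < suc ℓ ] ∑[ r < x ] (β + y s r) ≡ suc ℓ * (x * β) + ∑[ s < suc ℓ ] ∑[ r < x ] y s r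
  insert-later = trans
    (sum-cong-≗ {suc ℓ} (λ s → trans (∑-distrib-+ {x} (λ _ → β) (y s)) (cong (_+ ∑[ r < x ] y s r) (∑-const x β))))
    (trans (∑-distrib-+ {suc ℓ} (λ _ → x * β) (λ s → ∑[ r < x ] y s r))
           (cong (_+ ∑[ s < suc ℓ ] ∑[ r < x ] y s r) (∑-const (suc ℓ) (x * β))))

-- Inserting at the front replaces the step u → a by u → 1 → a, and by ∑-around-1 these changes
-- telescope along the word, leaving only the contribution of u.
descents-∑-insert : ∀ x u {ℓ} {v : Vec (ℕ × ℕ) ℓ} → All Large v →
  ∑[ s < suc ℓ ] ∑[ r < x ] descents u (insertAt v s (1 , toℕ r)) + x * descents u v + x
  ≡ x * suc ℓ * suc (descents u v) + ∑[ r < x ] desBit u (1 , toℕ r)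
descents-∑-insert x u {v = []} [] = begin
  ∑[ r < x ] (desBit u (1 , toℕ r) + 0) + 0 + x * 0 + x
    ≡⟨ cong (λ t → t + 0 + x * 0 + x) (sum-cong-≗ {x} (λ r → +-identityʳ (desBit u (1 , toℕ r)))) ⟩
  ∑[ r < x ] desBit u (1 , toℕ r) + 0 + x * 0 + x
    ≡⟨ identity (∑[ r < x ] desBit u (1 , toℕ r)) x ⟩
  x * 1 * 1 + ∑[ r < x ] desBit u (1 , toℕ r)
    ∎
  where
  open ≡-Reasoning
  identity : ∀ a x → a + 0 + x * 0 + x ≡ x * 1 * 1 + a
  identity = solve-∀
descents-∑-insert x u {suc ℓ} {a ∷ v} (large-a ∷ large-v) = begin
  Tᵤ + x * (β + D) + x
    ≡⟨ cong (λ t → t + x * (β + D) + x) (∑-insert-cons x u a v) ⟩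
  A u + (B + x * D) + (suc ℓ * (x * β) + Tₐ) + x * (β + D) + x
    ≡⟨ regroup (A u) B D β ℓ Tₐ x ⟩
  (Tₐ + x * D + x) + (B + A u + suc ℓ * (x * β) + x * β + x * D)
    ≡⟨ cong (_+ (B + A u + suc ℓ * (x * β) + x * β + x * D)) (descents-∑-insert x a large-v) ⟩
  x * suc ℓ * suc D + A a + (B + A u + suc ℓ * (x * β) + x * β + x * D)
    ≡⟨ regroup′ (A a) (A u) B D β ℓ x ⟩
  x * suc ℓ * suc D + (A a + B) + (A u + suc ℓ * (x * β) + x * β + x * D)
    ≡⟨ cong (λ t → x * suc ℓ * suc D + t + (A u + suc ℓ * (x * β) + x * β + x * D)) (∑-around-1 x large-a) ⟩
  x * suc ℓ * suc D + x + (A u + suc ℓ * (x * β) + x * β + x * D)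
    ≡⟨ collect (A u) D β ℓ x ⟩
  x * suc (suc ℓ) * suc (β + D) + A u
    ∎
  where
  open ≡-Reasoning
  A : ℕ × ℕ → ℕ
  A w = ∑[ r < x ] desBit w (1 , toℕ r)
  B = ∑[ r < x ] desBit (1 , toℕ r) a
  β = desBit u a
  D = descents a v
  Tᵤ = ∑[ s < suc (suc ℓ) ] ∑[ r < x ] descents u (insertAt (a ∷ v) s (1 , toℕ r))
  Tₐ = ∑[ s < suc ℓ ] ∑[ r < x ] descents a (insertAt v s (1 , toℕ r))
  regroup : ∀ a b d β ℓ t x → a + (b + x * d) + (suc ℓ * (x * β) + t) + x * (β + d) + x
    ≡ (t + x * d + x) + (b + a + suc ℓ * (x * β) + x * β + x * d)
  regroup = solve-∀
  regroup′ : ∀ a′ a b d β ℓ x → x * suc ℓ * suc d + a′ + (b + a + suc ℓ * (x * β) + x * β + x * d)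
    ≡ x * suc ℓ * suc d + (a′ + b) + (a + suc ℓ * (x * β) + x * β + x * d)
  regroup′ = solve-∀
  collect : ∀ a d β ℓ x → x * suc ℓ * suc d + x + (a + suc ℓ * (x * β) + x * β + x * d)
    ≡ x * suc (suc ℓ) * suc (β + d) + a
  collect = solve-∀

∑-insert-weight : ∀ x′ {ℓ} {v : Vec (ℕ × ℕ) ℓ} → All Large v → ∀ G →
  ∑[ s < suc ℓ ] ∑[ r < suc x′ ] G (descents (0 , 0) (insertAt v s (1 , toℕ r)))
    + (1 + suc x′ * descents (0 , 0) v) * G (suc (descents (0 , 0) v))
  ≡ (1 + suc x′ * descents (0 , 0) v) * G (descents (0 , 0) v) + suc ℓ * (suc x′ * G (suc (descents (0 , 0) v)))
∑-insert-weight x′ {ℓ} {v} large-v =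
  ∑∑-two-values {suc ℓ} {x} (λ s r → descents-insert-1 sentinel large-v s (toℕ r)) (1 + x * d) (+-cancelʳ-≡ x′ _ _ (begin
    Y + (1 + x * d) + x′       ≡⟨ regroup Y x′ d ⟩
    Y + x * d + x              ≡⟨ descents-∑-insert x (0 , 0) large-v ⟩
    x * suc ℓ * suc d + ∑[ r < x ] desBit (0 , 0) (1 , toℕ r) ≡⟨ cong (x * suc ℓ * suc d +_) (∑-sentinel-1 x′) ⟩
    x * suc ℓ * suc d + x′     ≡⟨ cong (_+ x′) (reorder x (suc ℓ) (suc d)) ⟩
    suc ℓ * (x * suc d) + x′   ∎))
  where
  open ≡-Reasoning
  x = suc x′
  d = descents (0 , 0) v
  Y = ∑[ s < suc ℓ ] ∑[ r < x ] descents (0 , 0) (insertAt v s (1 , toℕ r))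
  regroup : ∀ y x′ d → y + (1 + suc x′ * d) + x′ ≡ y + suc x′ * d + suc x′
  regroup = solve-∀
  reorder : ∀ x l e → x * l * e ≡ l * (x * e)
  reorder = solve-∀

∑-insert-quotWeight : ∀ m k x′ {v : Vec (ℕ × ℕ) m} → All Large v →
  ∑[ s < suc m ] ∑[ r < suc x′ ] quotWeight (suc m) k (descents (0 , 0) (insertAt v s (1 , toℕ r)))
  ≡ quotWeight m k (descents (0 , 0) v) * (1 + suc x′ * k)
∑-insert-quotWeight m k x′ {v} large-v = +-cancelʳ-≡ ((1 + x * d) * W (suc d)) _ _ (begin
  S + (1 + x * d) * W (suc d)                        ≡⟨ ∑-insert-weight x′ large-v W ⟩
  (1 + x * d) * W d + suc m * (x * W (suc d))        ≡⟨ cong ((1 + x * d) * W d +_) (reorder (suc m) x (W (suc d))) ⟩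
  (1 + x * d) * W d + x * suc m * W (suc d)          ≡⟨ quotWeight-recurrence m x k d 1 ⟩
  quotWeight m k d * (1 + x * k) + (1 + x * d) * W (suc d) ∎)
  where
  open ≡-Reasoning
  x = suc x′
  d = descents (0 , 0) v
  W = quotWeight (suc m) k
  S = ∑[ s < suc m ] ∑[ r < x ] W (descents (0 , 0) (insertAt v s (1 , toℕ r)))
  reorder : ∀ l x w → l * (x * w) ≡ x * l * w
  reorder = solve-∀

-- Coloured permutations as insertions of the letter 1

Pointwise-irrelevant : ∀ {A B : Set} {R : A → B → Set} → (∀ {a b} (p q : R a b) → p ≡ q) →
  ∀ {k} {xs : Vec A k} {ys : Vec B k} (p q : Pointwise R xs ys) → p ≡ q
Pointwise-irrelevant irr [] [] = refl
Pointwise-irrelevant irr (p ∷ ps) (q ∷ qs) = cong₂ _∷_ (irr p q) (Pointwise-irrelevant irr ps qs)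

Pointwise-insertAt : ∀ {A B : Set} {R : A → B → Set} {k} {xs : Vec A k} {ys : Vec B k} {a b} →
  Pointwise R xs ys → R a b → ∀ s → Pointwise R (insertAt xs s a) (insertAt ys s b)
Pointwise-insertAt ps r Fin.zero = r ∷ ps
Pointwise-insertAt (p ∷ ps) r (Fin.suc s) = p ∷ Pointwise-insertAt ps r s

Pointwise-removeAt : ∀ {A B : Set} {R : A → B → Set} {k} {xs : Vec A (suc k)} {ys : Vec B (suc k)} →
  Pointwise R xs ys → ∀ s → Pointwise R (removeAt xs s) (removeAt ys s)
Pointwise-removeAt (p ∷ ps) Fin.zero = ps
Pointwise-removeAt (p ∷ q ∷ qs) (Fin.suc s) = p ∷ Pointwise-removeAt (q ∷ qs) s

Pointwise-mapˡ⁺ : ∀ {A A′ B : Set} {R : A′ → B → Set} (f : A → A′) {k} {xs : Vec A k} {ys : Vec B k} →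
  Pointwise (R ∘ f) xs ys → Pointwise R (map f xs) ys
Pointwise-mapˡ⁺ f [] = []
Pointwise-mapˡ⁺ f (p ∷ ps) = p ∷ Pointwise-mapˡ⁺ f ps

Pointwise-mapˡ⁻ : ∀ {A A′ B : Set} {R : A′ → B → Set} (f : A → A′) {k} (xs : Vec A k) {ys : Vec B k} →
  Pointwise R (map f xs) ys → Pointwise (R ∘ f) xs ys
Pointwise-mapˡ⁻ f [] [] = []
Pointwise-mapˡ⁻ f (x ∷ xs) (p ∷ ps) = p ∷ Pointwise-mapˡ⁻ f xs ps

count-insertAt : ∀ {A : Set} {P : A → Set} (P? : Decidable P) {k} (v : Vec A k) s a →
  count P? (insertAt v s a) ≡ count P? (a ∷ v)
count-insertAt P? v Fin.zero a = refl
count-insertAt P? (y ∷ v) (Fin.suc s) a with does (P? y) | does (P? a) | count-insertAt P? v s a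
... | true  | true  | e = cong suc e
... | true  | false | e = cong suc e
... | false | true  | e = e
... | false | false | e = e

count-removeAt : ∀ {A : Set} {P : A → Set} (P? : Decidable P) {k} (v : Vec A (suc k)) s →
  count P? v ≡ count P? (lookup v s ∷ removeAt v s)
count-removeAt P? v s =
  trans (cong (count P?) (sym (insertAt-removeAt v s))) (count-insertAt P? (removeAt v s) s (lookup v s))

count-map-suc-zero : ∀ {m k} (v : Vec (Fin m) k) → count (_≟ Fin.zero) (map Fin.suc v) ≡ 0
count-map-suc-zero [] = refl
count-map-suc-zero (a ∷ v) = count-map-suc-zero v

count-map-suc : ∀ {m k} (j : Fin m) (v : Vec (Fin m) k) → count (_≟ Fin.suc j) (map Fin.suc v) ≡ count (_≟ j) v
count-map-suc j [] = refl
count-map-suc j (a ∷ v) with does (a ≟ j)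
... | true  = cong suc (count-map-suc j v)
... | false = count-map-suc j v

IsPermWord-intro : ∀ {n} (w : Vec (Fin n) n) → (∀ j → count (_≟ j) w ≡ 1) → IsPermWord n w
IsPermWord-intro w once = ListAll.tabulate (λ {j} _ → once j)

IsPermWord-once : ∀ {n} (w : Vec (Fin n) n) → IsPermWord n w → ∀ j → count (_≟ j) w ≡ 1
IsPermWord-once w perm j = ListAll.lookup perm (∈-allFin j)

ColouredPerm-≡ : ∀ {n c} {w w′ : Vec (Fin n) n} {γ γ′ : Vec ℕ n} {pw pw′ pγ pγ′} → w ≡ w′ → γ ≡ γ′ →
  _≡_ {A = ColouredPerm n c} (w , pw , γ , pγ) (w′ , pw′ , γ′ , pγ′)
ColouredPerm-≡ {w = w} {γ = γ} {pw = pw} {pw′} {pγ} {pγ′} refl refl =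
  cong₂ (λ p q → w , p , γ , q) (ListAll.irrelevant ≡-irrelevant pw pw′) (Pointwise-irrelevant <-irrelevant pγ pγ′)

zero-position : ∀ {m k} (v : Vec (Fin (suc m)) k) → count (_≟ Fin.zero) v ≡ 1 →
  Σ (Fin k) (λ s → lookup v s ≡ Fin.zero)
zero-position (Fin.zero ∷ v) _ = Fin.zero , refl
zero-position (Fin.suc a ∷ v) once with s , e ← zero-position v once = Fin.suc s , e

zero-position-insertAt : ∀ {m k} (w : Vec (Fin m) k) s once →
  proj₁ (zero-position (insertAt (map Fin.suc w) s Fin.zero) once) ≡ s
zero-position-insertAt w Fin.zero once = refl
zero-position-insertAt (a ∷ w) (Fin.suc s) once = cong Fin.suc (zero-position-insertAt w s once)

unsuc : ∀ {m k} (v : Vec (Fin (suc m)) k) → count (_≟ Fin.zero) v ≡ 0 → Vec (Fin m) k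
unsuc [] _ = []
unsuc (Fin.suc a ∷ v) none = a ∷ unsuc v none

map-suc-unsuc : ∀ {m k} (v : Vec (Fin (suc m)) k) none → map Fin.suc (unsuc v none) ≡ v
map-suc-unsuc [] none = refl
map-suc-unsuc (Fin.suc a ∷ v) none = cong (Fin.suc a ∷_) (map-suc-unsuc v none)

unsuc-map-suc : ∀ {m k} (w : Vec (Fin m) k) none → unsuc (map Fin.suc w) none ≡ w
unsuc-map-suc [] none = refl
unsuc-map-suc (a ∷ w) none = cong (a ∷_) (unsuc-map-suc w none)

unsuc-cong : ∀ {m k} {v v′ : Vec (Fin (suc m)) k} {none none′} → v ≡ v′ → unsuc v none ≡ unsuc v′ none′
unsuc-cong refl = cong (unsuc _) (≡-irrelevant _ _)

module SmallestLetter (m x : ℕ) (c : Vec ℕ m) where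

  Insertion : Set
  Insertion = ColouredPerm m c × Fin (suc m) × Fin x

  -- The letters of p become 2, …, m + 1 and the new letter 1 (that is, Fin.zero) gets colour r.
  insert : Insertion → ColouredPerm (suc m) (x ∷ c)
  insert ((w , perm , γ , coloured) , s , r) =
    w′ , IsPermWord-intro w′ once , insertAt γ s (toℕ r) ,
    Pointwise-insertAt (Pointwise-mapˡ⁺ {R = λ a g → g < lookup (x ∷ c) a} Fin.suc coloured) (toℕ<n r) s
    where
    w′ = insertAt (map Fin.suc w) s Fin.zero
    once : ∀ j → count (_≟ j) w′ ≡ 1
    once Fin.zero = trans (count-insertAt (_≟ Fin.zero) (map Fin.suc w) s Fin.zero) (cong suc (count-map-suc-zero w))
    once (Fin.suc j) = trans (count-insertAt (_≟ Fin.suc j) (map Fin.suc w) s Fin.zero)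
                             (trans (count-map-suc j w) (IsPermWord-once w perm j))

  removeAt-zero : (q : ColouredPerm (suc m) (x ∷ c)) → ∀ s → lookup (proj₁ q) s ≡ Fin.zero → Insertion
  removeAt-zero (w , perm , γ , coloured) s w[s]≡0 =
    (unsuc rest none , IsPermWord-intro (unsuc rest none) once , removeAt γ s , coloured-rest) , s , fromℕ< γ[s]<x
    where
    rest = removeAt w s
    count-rest : ∀ j → count (_≟ j) w ≡ count (_≟ j) (Fin.zero ∷ rest)
    count-rest j = trans (count-removeAt (_≟ j) w s) (cong (λ a → count (_≟ j) (a ∷ rest)) w[s]≡0)
    none : count (_≟ Fin.zero) rest ≡ 0
    none = suc-injective (trans (sym (count-rest Fin.zero)) (IsPermWord-once w perm Fin.zero))
    once : ∀ j → count (_≟ j) (unsuc rest none) ≡ 1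
    once j = begin
      count (_≟ j) (unsuc rest none)                         ≡⟨ count-map-suc j (unsuc rest none) ⟨
      count (_≟ Fin.suc j) (map Fin.suc (unsuc rest none))   ≡⟨ cong (count (_≟ Fin.suc j)) (map-suc-unsuc rest none) ⟩
      count (_≟ Fin.suc j) (Fin.zero ∷ rest)                 ≡⟨ count-rest (Fin.suc j) ⟨
      count (_≟ Fin.suc j) w                                 ≡⟨ IsPermWord-once w perm (Fin.suc j) ⟩
      1                                                      ∎
      where open ≡-Reasoning
    coloured-rest : Pointwise (λ a g → g < lookup c a) (unsuc rest none) (removeAt γ s)
    coloured-rest = Pointwise-mapˡ⁻ Fin.suc (unsuc rest none)
      (subst (λ v → Pointwise _ v (removeAt γ s)) (sym (map-suc-unsuc rest none)) (Pointwise-removeAt coloured s))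
    γ[s]<x : lookup γ s < x
    γ[s]<x = subst (λ a → lookup γ s < lookup (x ∷ c) a) w[s]≡0 (Pointwise.lookup coloured s)

  remove : ColouredPerm (suc m) (x ∷ c) → Insertion
  remove q@(w , perm , _) with s , w[s]≡0 ← zero-position w (IsPermWord-once w perm Fin.zero) =
    removeAt-zero q s w[s]≡0

  removeAt-zero-insert : ∀ t s e → s ≡ proj₁ (proj₂ t) → removeAt-zero (insert t) s e ≡ t
  removeAt-zero-insert ((w , perm , γ , coloured) , s , r) .s e refl =
    cong₂ _,_ (ColouredPerm-≡ {c = c} unsuc-insert (removeAt-insertAt γ s (toℕ r)))
              (cong (s ,_) (toℕ-injective (trans (toℕ-fromℕ< _) (insertAt-lookup γ s (toℕ r)))))
    where
    unsuc-insert : ∀ {none} → unsuc (removeAt (insertAt (map Fin.suc w) s Fin.zero) s) none ≡ w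
    unsuc-insert =
      trans (unsuc-cong (removeAt-insertAt (map Fin.suc w) s Fin.zero)) (unsuc-map-suc w (count-map-suc-zero w))

  remove-insert : ∀ t → remove (insert t) ≡ t
  remove-insert t@((w , _) , s , _) = removeAt-zero-insert t _ _ (zero-position-insertAt w s _)

  insert-removeAt-zero : ∀ q s e → insert (removeAt-zero q s e) ≡ q
  insert-removeAt-zero (w , perm , γ , coloured) s w[s]≡0 = ColouredPerm-≡ {c = x ∷ c}
    (trans (cong (λ v → insertAt v s Fin.zero) (map-suc-unsuc (removeAt w s) _))
      (trans (cong (insertAt (removeAt w s) s) (sym w[s]≡0)) (insertAt-removeAt w s)))
    (trans (cong (insertAt (removeAt γ s) s) (toℕ-fromℕ< _)) (insertAt-removeAt γ s))

  insertion : Insertion ↔ ColouredPerm (suc m) (x ∷ c)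
  insertion = mk↔ₛ′ insert remove (λ q → insert-removeAt-zero q _ _) remove-insert

letters : ∀ {n ℓ} → Vec (Fin n) ℓ → Vec ℕ ℓ → Vec (ℕ × ℕ) ℓ
letters [] [] = []
letters (a ∷ w) (g ∷ γ) = (suc (toℕ a) , g) ∷ letters w γ

toList-letters : ∀ {n ℓ} (w : Vec (Fin n) ℓ) γ →
  List.zip (List.map (λ j → suc (toℕ j)) (toList w)) (toList γ) ≡ toList (letters w γ)
toList-letters [] [] = refl
toList-letters (a ∷ w) (g ∷ γ) = cong (_ List.∷_) (toList-letters w γ)

des≡descents : ∀ {n c} (p : ColouredPerm n c) → des n c p ≡ descents (0 , 0) (letters (proj₁ p) (proj₁ (proj₂ (proj₂ p))))
des≡descents (w , _ , γ , _) = cong (λ l → desList ((0 , 0) List.∷ l)) (toList-letters w γ)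

raise : ℕ × ℕ → ℕ × ℕ
raise (a , g) = suc a , g

desBit-raise : ∀ u v → desBit (raise u) (raise v) ≡ desBit u v
desBit-raise (a , g) (zero , h) = refl
desBit-raise (a , g) (suc b , h) = refl

desBit-sentinel-raise : ∀ v → desBit (0 , 0) (raise v) ≡ desBit (0 , 0) v
desBit-sentinel-raise (zero , h) = refl
desBit-sentinel-raise (suc b , h) = refl

descents-raise : ∀ {ℓ} u (v : Vec (ℕ × ℕ) ℓ) → descents (raise u) (map raise v) ≡ descents u v
descents-raise u [] = refl
descents-raise u (a ∷ v) = cong₂ _+_ (desBit-raise u a) (descents-raise a v)

descents-sentinel-raise : ∀ {ℓ} (v : Vec (ℕ × ℕ) ℓ) → descents (0 , 0) (map raise v) ≡ descents (0 , 0) v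
descents-sentinel-raise [] = refl
descents-sentinel-raise (a ∷ v) = cong₂ _+_ (desBit-sentinel-raise a) (descents-raise a v)

raise-letters-large : ∀ {n ℓ} (w : Vec (Fin n) ℓ) γ → All Large (map raise (letters w γ))
raise-letters-large [] [] = []
raise-letters-large (a ∷ w) (g ∷ γ) = large (toℕ a) g ∷ raise-letters-large w γ

letters-map-suc : ∀ {n ℓ} (w : Vec (Fin n) ℓ) γ → letters (map Fin.suc w) γ ≡ map raise (letters w γ)
letters-map-suc [] [] = refl
letters-map-suc (a ∷ w) (g ∷ γ) = cong (_ ∷_) (letters-map-suc w γ)

letters-insert : ∀ {n ℓ} (w : Vec (Fin n) ℓ) γ s g →
  letters (insertAt (map Fin.suc w) s Fin.zero) (insertAt γ s g) ≡ insertAt (map raise (letters w γ)) s (1 , g)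
letters-insert w γ Fin.zero g = cong (_ ∷_) (letters-map-suc w γ)
letters-insert (a ∷ w) (h ∷ γ) (Fin.suc s) g = cong (_ ∷_) (letters-insert w γ s g)

WeightedPerms : (n : ℕ) → Vec ℕ n → ℕ → Set
WeightedPerms n c k = Σ (ColouredPerm n c) (λ p → Fin (quotWeight n k (des n c p)))

module _ (m x′ : ℕ) (c : Vec ℕ m) (k : ℕ) where

  open SmallestLetter m (suc x′) c

  private
    x = suc x′

  des-insert : ∀ w perm γ coloured s r → des (suc m) (x ∷ c) (insert ((w , perm , γ , coloured) , s , r))
    ≡ descents (0 , 0) (insertAt (map raise (letters w γ)) s (1 , toℕ r))
  des-insert w perm γ coloured s r =
    trans (des≡descents {c = x ∷ c} (insert ((w , perm , γ , coloured) , s , r)))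
          (cong (descents (0 , 0)) (letters-insert w γ s (toℕ r)))

  ∑-insert-des : ∀ p → ∑[ s < suc m ] ∑[ r < x ] quotWeight (suc m) k (des (suc m) (x ∷ c) (insert (p , s , r)))
                     ≡ quotWeight m k (des m c p) * (1 + x * k)
  ∑-insert-des p@(w , perm , γ , coloured) = begin
    ∑[ s < suc m ] ∑[ r < x ] quotWeight (suc m) k (des (suc m) (x ∷ c) (insert (p , s , r)))
      ≡⟨ sum-cong-≗ {suc m} (λ s → sum-cong-≗ {x} (λ r →
           cong (quotWeight (suc m) k) (des-insert w perm γ coloured s r))) ⟩
    ∑[ s < suc m ] ∑[ r < x ] quotWeight (suc m) k (descents (0 , 0) (insertAt (map raise (letters w γ)) s (1 , toℕ r)))
      ≡⟨ ∑-insert-quotWeight m k x′ (raise-letters-large w γ) ⟩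
    quotWeight m k (descents (0 , 0) (map raise (letters w γ))) * (1 + x * k)
      ≡⟨ cong (λ d → quotWeight m k d * (1 + x * k))
              (trans (descents-sentinel-raise (letters w γ)) (sym (des≡descents {c = c} p))) ⟩
    quotWeight m k (des m c p) * (1 + x * k)
      ∎
    where open ≡-Reasoning

  WeightedPerms-insert : WeightedPerms (suc m) (x ∷ c) k ↔ (WeightedPerms m c k × Fin (1 + x * k))
  WeightedPerms-insert = begin
    WeightedPerms (suc m) (x ∷ c) k
      ↔⟨ ↔-sym (Σ-↔ insertion ↔-refl) ⟩
    Σ Insertion (λ t → Fin (W (insert t)))
      ↔⟨ mk↔ₛ′ (λ ((p , s , r) , i) → p , s , r , i) (λ (p , s , r , i) → (p , s , r) , i) (λ _ → refl) (λ _ → refl) ⟩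
    Σ (ColouredPerm m c) (λ p → Σ (Fin (suc m)) λ s → Σ (Fin x) λ r → Fin (W (insert (p , s , r))))
      ↔⟨ Σ-↔ ↔-refl (λ {p} → ↔-trans (Σ-↔ ↔-refl (λ {s} → Σ-Fin x (λ r → W (insert (p , s , r)))))
                                     (Σ-Fin (suc m) (λ s → ∑[ r < x ] W (insert (p , s , r))))) ⟩
    Σ (ColouredPerm m c) (λ p → Fin (∑[ s < suc m ] ∑[ r < x ] W (insert (p , s , r))))
      ↔⟨ Σ-↔ ↔-refl (λ {p} → ↔-trans (Fin-cong (∑-insert-des p)) (↔-sym (Fin-× _ _))) ⟩
    Σ (ColouredPerm m c) (λ p → Fin (quotWeight m k (des m c p)) × Fin (1 + x * k))
      ↔⟨ mk↔ₛ′ (λ (p , i , j) → (p , i) , j) (λ ((p , i) , j) → p , i , j) (λ _ → refl) (λ _ → refl) ⟩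
    (WeightedPerms m c k × Fin (1 + x * k))
      ∎
    where
    open EquationalReasoning
    W : ColouredPerm (suc m) (x ∷ c) → ℕ
    W q = quotWeight (suc m) k (des (suc m) (x ∷ c) q)

WeightedPerms-box : ∀ n (c : Vec ℕ n) k → All (1 ≤_) c → WeightedPerms n c k HasSize boxPoints c k
WeightedPerms-box zero [] k [] =
  mk↔ₛ′ (λ { (([] , ListAll.[] , [] , []) , i) → i }) (λ i → ([] , ListAll.[] , [] , []) , i) (λ _ → refl)
        (λ { (([] , ListAll.[] , [] , []) , i) → refl })
WeightedPerms-box (suc m) (suc x′ ∷ c) k (s≤s z≤n ∷ positive) = begin
  WeightedPerms (suc m) (suc x′ ∷ c) k
    ↔⟨ WeightedPerms-insert m x′ c k ⟩
  (WeightedPerms m c k × Fin (1 + suc x′ * k))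
    ↔⟨ ×-cong (WeightedPerms-box m c k positive) (Fin-cong (points x′ k)) ⟩
  (Fin (boxPoints c k) × Fin (intervalPoints (suc x′) k))
    ↔⟨ Fin-× _ _ ⟩
  Fin (boxPoints c k * intervalPoints (suc x′) k)
    ↔⟨ Fin-cong (trans (*-comm (boxPoints c k) _) (sym (boxPoints-∷ (suc x′) c k))) ⟩
  Fin (boxPoints (suc x′ ∷ c) k)
    ∎
  where
  open EquationalReasoning
  points : ∀ x′ k → 1 + suc x′ * k ≡ x′ * k + suc k
  points = solve-∀

WeightedPerms-quotCoeff : ∀ n (c : Vec ℕ n) k (D : ℕ → ℕ) → (∀ j → DesLevel n c j HasSize D j) →
  WeightedPerms n c k HasSize quotCoeff n D k
WeightedPerms-quotCoeff n c k D levels = begin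
  WeightedPerms n c k
    ↔⟨ Σ-fibres (Fin ∘ W) (des n c) ⟩
  Σ ℕ (λ d → DesLevel n c d × Fin (W d))
    ↔⟨ Σ-↔ ↔-refl (λ {d} → ↔-trans (×-cong (levels d) ↔-refl) (Fin-× (D d) (W d))) ⟩
  Σ ℕ (λ d → Fin (D d * W d))
    ↔⟨ Σℕ-Fin (suc k) (λ d → D d * W d) vanish ⟩
  Fin (∑[ j < suc k ] (D (toℕ j) * W (toℕ j)))
    ↔⟨ Fin-cong ∑≡quotCoeff ⟩
  Fin (quotCoeff n D k)
    ∎
  where
  open EquationalReasoning
  W = quotWeight n k
  vanish : ∀ d → k < d → D d * W d ≡ 0
  vanish d k<d = trans (cong (D d *_) (quotWeight-vanish n k<d)) (*-zeroʳ (D d))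
  ∑≡quotCoeff : ∑[ j < suc k ] (D (toℕ j) * W (toℕ j)) ≡ quotCoeff n D k
  ∑≡quotCoeff = trans
    (sum-cong-≗ {suc k} (λ j → trans (*-comm (D (toℕ j)) (W (toℕ j)))
                                     (cong (_* D (toℕ j)) (quotWeight≡C n (≤-pred (toℕ<n j))))))
    (sym (sum-applyUpTo (suc k) (λ j → ((n + (k ∸ j)) C n) * D j) (λ j → j)))

proposition5p7 : (n : ℕ) (c : Vec ℕ n) → All (1 ≤_) c →
    (D : ℕ → ℕ) → (∀ j → DesLevel n c j HasSize D j) →
    (e : Fin n → ℕ → ℕ) → (∀ i k → IntervalPts (lookup c i) k HasSize e i k) →
    (E : ℕ → ℕ) → (∀ k → BoxPts n c k HasSize E k) →
    ∀ k → (quotCoeff n D k ≡ prodFin n (λ i → e i k)) × (prodFin n (λ i → e i k) ≡ E k)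
proposition5p7 n c positive D levels e intervals E boxes k =
  trans (size-unique (WeightedPerms-quotCoeff n c k D levels) (WeightedPerms-box n c k positive)) (sym e≡boxPoints) ,
  trans e≡boxPoints (size-unique (BoxPts-size n c k) (boxes k))
  where
  e≡boxPoints : prodFin n (λ i → e i k) ≡ boxPoints c k
  e≡boxPoints = cong product (map-cong (λ i → size-unique (intervals i k) (Interval-size _ k)) (List.allFin n))
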